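{- Let $k\ge5$, $d\in\mathbb{N}$, and let $(H_i,e_i)_{i\in[d]}$ be a simple $K_k$-chain. If $F$ is a copy of $K_k^-$ in $G:=\bigcup_{i\in[d]}H_i$, then there is some $i\in[d]$ with $F\subseteq H_i$.
   Context: $K_k^-$ is $K_k$ with one edge removed. A simple $K_k$-chain $(H_i,e_i)_{i=1}^d$ of length $d$ consists of copies $H_1,\dots,H_d$ of $K_k$ such that for $1\le i<j\le d$, $V(H_i)\cap V(H_j)=\emptyset$ unless $j=i+1$, in which case $|V(H_i)\cap V(H_{i+1})|=2$ and $e_i$ is the edge spanned by this intersection; and $e_d$ is an edge of $H_d$ vertex-disjoint from $e_{d-1}$. -}

module Defs where

open import Data.Nat using (ℕ; suc; _<_)
open import Data.Fin using (Fin; toℕ)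
open import Data.Product using (Σ; ∃; _×_; _,_)
open import Data.Sum using (_⊎_)
open import Relation.Nullary using (¬_)
open import Relation.Binary.PropositionalEquality using (_≡_; _≢_)
open import Function.Definitions using (Injective)

-- Vertices are natural numbers. A copy of K_k is given by an injective
-- labelling of its k vertices; its edges are all pairs of distinct vertices.
record CopyK (k : ℕ) : Set where
  field
    vtx : Fin k → ℕ
    inj : Injective _≡_ _≡_ vtx
open CopyK public

_∈V_ : ℕ → {k : ℕ} → CopyK k → Set
v ∈V H = ∃ λ a → vtx H a ≡ v

IsEdgeOf : {k : ℕ} → ℕ → ℕ → CopyK k → Set
IsEdgeOf u v H = (u ∈V H) × (v ∈V H) × (u ≢ v)

Disjoint : {k : ℕ} → CopyK k → CopyK k → Set
Disjoint H H' = ∀ v → v ∈V H → ¬ (v ∈V H')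

IntersectsIn : {k : ℕ} → CopyK k → CopyK k → ℕ × ℕ → Set
IntersectsIn H H' (u , v) =
  u ≢ v × (u ∈V H) × (u ∈V H') × (v ∈V H) × (v ∈V H')
  × (∀ w → w ∈V H → w ∈V H' → (w ≡ u) ⊎ (w ≡ v))

EdgesDisjoint : ℕ × ℕ → ℕ × ℕ → Set
EdgesDisjoint (u , v) (x , y) = u ≢ x × u ≢ y × v ≢ x × v ≢ y

-- A simple K_k-chain (H_i , e_i)_{i ∈ [d]}, indices i ∈ Fin d (0-based).
record SimpleChain (k d : ℕ) : Set where
  field
    H : Fin d → CopyK k
    e : Fin d → ℕ × ℕ
    far-disjoint : ∀ i j → toℕ i < toℕ j → toℕ j ≢ suc (toℕ i) →
                   Disjoint (H i) (H j)
    consecutive : ∀ i j → toℕ j ≡ suc (toℕ i) → IntersectsIn (H i) (H j) (e i)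
    last-edge : ∀ i → suc (toℕ i) ≡ d →
                IsEdgeOf (Data.Product.proj₁ (e i)) (Data.Product.proj₂ (e i)) (H i)
    last-disjoint : ∀ i j → suc (toℕ j) ≡ d → toℕ j ≡ suc (toℕ i) →
                    EdgesDisjoint (e i) (e j)
open SimpleChain public

AdjG : {k d : ℕ} → SimpleChain k d → ℕ → ℕ → Set
AdjG C u v = ∃ λ i → IsEdgeOf u v (H C i)

-- A copy of K_k^- in G: k distinct vertices φ(0..k-1) and a designated
-- non-edge {x,y} (x ≠ y) of K_k such that every other pair is an edge of G.
record CopyKminusIn {k d : ℕ} (C : SimpleChain k d) : Set where
  field
    φ : Fin k → ℕ
    φ-inj : Injective _≡_ _≡_ φ
    x y : Fin k
    x≢y : x ≢ y
    edges : ∀ a b → a ≢ b → ¬ ((a ≡ x × b ≡ y) ⊎ (a ≡ y × b ≡ x)) →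
            AdjG C (φ a) (φ b)
open CopyKminusIn public

-- F ⊆ H_i : every vertex of F is a vertex of H_i (since H_i is complete,
-- all edges of F are then edges of H_i as well).
_⊆H_ : {k d : ℕ} {C : SimpleChain k d} → CopyKminusIn C → CopyK k → Set
F ⊆H Hi = ∀ a → φ F a ∈V Hi

-- Two distinct copies in the chain share at most two vertices and no vertex lies in
-- three of them, since only consecutive copies meet. Hence every triangle of G lies
-- in a single copy H_i, and a vertex adjacent in G to three vertices of H_i lies in
-- H_i itself. As k ≥ 5, the copy F of K_k^- has three vertices outside its non-edge;
-- they span a triangle, hence lie in some H_i, and every other vertex of F is
-- adjacent to all three of them, so F ⊆ H_i.
module Submission where

open import Defs
open import Data.Nat using (ℕ; _≤_; _+_; suc; s≤s; z≤n; <-cmp)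
import Data.Nat as ℕ
open import Data.Product using (∃; _×_; _,_; proj₁; proj₂)
open import Data.Sum using (_⊎_; inj₁; inj₂)
open import Data.Fin using (Fin; toℕ; _≟_; #_; punchIn; punchOut)
open import Data.Fin.Properties
  using (toℕ-injective; punchIn-injective; punchInᵢ≢i; punchIn-punchOut)
open import Data.Empty using (⊥; ⊥-elim)
open import Relation.Nullary using (yes; no)
open import Relation.Binary using (tri<; tri≈; tri>)
open import Relation.Binary.PropositionalEquality using (_≡_; _≢_; refl; sym; trans; ≢-sym)

three-distinct-∉-pair : {A : Set} {p q r u v : A} → p ≢ q → p ≢ r → q ≢ r →
                        p ≡ u ⊎ p ≡ v → q ≡ u ⊎ q ≡ v → r ≡ u ⊎ r ≡ v → ⊥
three-distinct-∉-pair p≢q p≢r q≢r (inj₁ refl) (inj₁ refl) _           = p≢q refl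
three-distinct-∉-pair p≢q p≢r q≢r (inj₂ refl) (inj₂ refl) _           = p≢q refl
three-distinct-∉-pair p≢q p≢r q≢r (inj₁ refl) (inj₂ refl) (inj₁ refl) = p≢r refl
three-distinct-∉-pair p≢q p≢r q≢r (inj₁ refl) (inj₂ refl) (inj₂ refl) = q≢r refl
three-distinct-∉-pair p≢q p≢r q≢r (inj₂ refl) (inj₁ refl) (inj₁ refl) = q≢r refl
three-distinct-∉-pair p≢q p≢r q≢r (inj₂ refl) (inj₁ refl) (inj₂ refl) = p≢r refl

Consecutive : ℕ → ℕ → Set
Consecutive a b = b ≡ suc a ⊎ a ≡ suc b

no-consecutive-triple : ∀ {a b c} → Consecutive a b → Consecutive b c → Consecutive a c → ⊥
no-consecutive-triple (inj₁ refl) (inj₁ refl) (inj₁ ())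
no-consecutive-triple (inj₁ refl) (inj₁ refl) (inj₂ ())
no-consecutive-triple (inj₁ refl) (inj₂ refl) (inj₁ ())
no-consecutive-triple (inj₁ refl) (inj₂ refl) (inj₂ ())
no-consecutive-triple (inj₂ refl) (inj₁ refl) (inj₁ ())
no-consecutive-triple (inj₂ refl) (inj₁ refl) (inj₂ ())
no-consecutive-triple (inj₂ refl) (inj₂ refl) (inj₁ ())
no-consecutive-triple (inj₂ refl) (inj₂ refl) (inj₂ ())

-- punchIn x ∘ punchIn y′, where y = punchIn x y′, misses exactly x and y.
module AvoidPair {n : ℕ} {x y : Fin (suc (suc n))} (x≢y : x ≢ y) where

  avoid : Fin n → Fin (suc (suc n))
  avoid a = punchIn x (punchIn (punchOut x≢y) a)

  avoid-injective : ∀ a b → avoid a ≡ avoid b → a ≡ b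
  avoid-injective a b eq =
    punchIn-injective _ a b (punchIn-injective x _ _ eq)

  avoid≢x : ∀ a → avoid a ≢ x
  avoid≢x a = punchInᵢ≢i x _

  avoid≢y : ∀ a → avoid a ≢ y
  avoid≢y a eq = punchInᵢ≢i (punchOut x≢y) a
    (punchIn-injective x _ _ (trans eq (sym (punchIn-punchOut x≢y))))

module _ {k d : ℕ} (C : SimpleChain k d) where

  shared-vertex⇒consecutive : ∀ {i j v} → i ≢ j → v ∈V H C i → v ∈V H C j →
                              Consecutive (toℕ i) (toℕ j)
  shared-vertex⇒consecutive {i} {j} {v} i≢j v∈i v∈j with <-cmp (toℕ i) (toℕ j)
  ... | tri≈ _ i≡j _ = ⊥-elim (i≢j (toℕ-injective i≡j))
  ... | tri< i<j _ _ with toℕ j ℕ.≟ suc (toℕ i)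
  ...   | yes j≡1+i = inj₁ j≡1+i
  ...   | no  j≢1+i = ⊥-elim (far-disjoint C i j i<j j≢1+i v v∈i v∈j)
  shared-vertex⇒consecutive {i} {j} {v} i≢j v∈i v∈j | tri> _ _ j<i
    with toℕ i ℕ.≟ suc (toℕ j)
  ...   | yes i≡1+j = inj₂ i≡1+j
  ...   | no  i≢1+j = ⊥-elim (far-disjoint C j i j<i i≢1+j v v∈j v∈i)

  no-three-shared-vertices : ∀ {i j p q r} → i ≢ j → p ≢ q → p ≢ r → q ≢ r →
    p ∈V H C i → p ∈V H C j → q ∈V H C i → q ∈V H C j → r ∈V H C i → r ∈V H C j → ⊥
  no-three-shared-vertices {i} {j} i≢j p≢q p≢r q≢r p∈i p∈j q∈i q∈j r∈i r∈j
    with shared-vertex⇒consecutive i≢j p∈i p∈j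
  ... | inj₁ j≡1+i =
    let (_ , _ , _ , _ , _ , ∩⊆e) = consecutive C i j j≡1+i in
    three-distinct-∉-pair p≢q p≢r q≢r (∩⊆e _ p∈i p∈j) (∩⊆e _ q∈i q∈j) (∩⊆e _ r∈i r∈j)
  ... | inj₂ i≡1+j =
    let (_ , _ , _ , _ , _ , ∩⊆e) = consecutive C j i i≡1+j in
    three-distinct-∉-pair p≢q p≢r q≢r (∩⊆e _ p∈j p∈i) (∩⊆e _ q∈j q∈i) (∩⊆e _ r∈j r∈i)

  no-vertex-in-three-copies : ∀ {i j l v} → i ≢ j → i ≢ l → j ≢ l →
    v ∈V H C i → v ∈V H C j → v ∈V H C l → ⊥
  no-vertex-in-three-copies i≢j i≢l j≢l v∈i v∈j v∈l =
    no-consecutive-triple (shared-vertex⇒consecutive i≢j v∈i v∈j)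
                          (shared-vertex⇒consecutive j≢l v∈j v∈l)
                          (shared-vertex⇒consecutive i≢l v∈i v∈l)

  triangle-in-copy : ∀ {u v w} → AdjG C u v → AdjG C v w → AdjG C u w →
                     ∃ λ i → u ∈V H C i × v ∈V H C i × w ∈V H C i
  triangle-in-copy (i , u∈i , v∈i , _) (j , v∈j , w∈j , _) (l , u∈l , w∈l , _)
    with i ≟ j | i ≟ l | j ≟ l
  ... | yes refl | _        | _        = i , u∈i , v∈i , w∈j
  ... | no _     | yes refl | _        = i , u∈i , v∈i , w∈l
  ... | no _     | no _     | yes refl = j , u∈l , v∈j , w∈j
  ... | no i≢j   | no i≢l   | no j≢l   = ⊥-elim (no-consecutive-triple
    (shared-vertex⇒consecutive i≢j v∈i v∈j)
    (shared-vertex⇒consecutive j≢l w∈j w∈l)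
    (shared-vertex⇒consecutive i≢l u∈i u∈l))

  -- The triangles t₁t₂w and t₁t₃w lie in copies j and j′. If neither is H_i, then
  -- either j = j′ shares t₁,t₂,t₃ with H_i, or t₁ lies in the three copies i, j, j′.
  common-neighbour-in-copy : ∀ {i t₁ t₂ t₃ w} → t₁ ≢ t₂ → t₁ ≢ t₃ → t₂ ≢ t₃ →
    t₁ ∈V H C i → t₂ ∈V H C i → t₃ ∈V H C i →
    AdjG C t₁ w → AdjG C t₂ w → AdjG C t₃ w → w ∈V H C i
  common-neighbour-in-copy {i} t₁≢t₂ t₁≢t₃ t₂≢t₃ t₁∈i t₂∈i t₃∈i t₁w t₂w t₃w
    with triangle-in-copy (i , t₁∈i , t₂∈i , t₁≢t₂) t₂w t₁w
       | triangle-in-copy (i , t₁∈i , t₃∈i , t₁≢t₃) t₃w t₁w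
  ... | j , t₁∈j , t₂∈j , w∈j | j′ , t₁∈j′ , t₃∈j′ , w∈j′ with j ≟ i | j′ ≟ i | j ≟ j′
  ... | yes refl | _        | _        = w∈j
  ... | no _     | yes refl | _        = w∈j′
  ... | no j≢i   | no _     | yes refl =
    ⊥-elim (no-three-shared-vertices j≢i t₁≢t₂ t₁≢t₃ t₂≢t₃ t₁∈j t₁∈i t₂∈j t₂∈i t₃∈j′ t₃∈i)
  ... | no j≢i   | no j′≢i  | no j≢j′  =
    ⊥-elim (no-vertex-in-three-copies j≢i j≢j′ (≢-sym j′≢i) t₁∈j t₁∈i t₁∈j′)

edge-off-non-edge : ∀ {k d} {C : SimpleChain k d} (F : CopyKminusIn C) {a b} →
  a ≢ x F → a ≢ y F → a ≢ b → AdjG C (φ F a) (φ F b)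
edge-off-non-edge F a≢x a≢y a≢b = edges F _ _ a≢b λ
  { (inj₁ (a≡x , _)) → a≢x a≡x
  ; (inj₂ (a≡y , _)) → a≢y a≡y }

mainTheorem3 : (k d : ℕ) → 5 ≤ k → (C : SimpleChain k d) → (F : CopyKminusIn C) →
    ∃ λ i → F ⊆H H C i
mainTheorem3 .(5 + m) d (s≤s (s≤s (s≤s (s≤s (s≤s {n = m} z≤n))))) C F = i , F⊆Hᵢ
  where
  open AvoidPair (x≢y F)

  φz : Fin (3 + m) → ℕ
  φz a = φ F (avoid a)

  φz-edge : ∀ a b → avoid a ≢ b → AdjG C (φz a) (φ F b)
  φz-edge a b = edge-off-non-edge F (avoid≢x a) (avoid≢y a)

  φz-adj : ∀ a b → a ≢ b → AdjG C (φz a) (φz b)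
  φz-adj a b a≢b = φz-edge a (avoid b) λ eq → a≢b (avoid-injective a b eq)

  φz-distinct : ∀ a b → a ≢ b → φz a ≢ φz b
  φz-distinct a b a≢b eq = a≢b (avoid-injective a b (φ-inj F eq))

  triangle : ∃ λ i → φz (# 0) ∈V H C i × φz (# 1) ∈V H C i × φz (# 2) ∈V H C i
  triangle = triangle-in-copy C (φz-adj (# 0) (# 1) λ ()) (φz-adj (# 1) (# 2) λ ())
                                (φz-adj (# 0) (# 2) λ ())

  i : Fin d
  i = proj₁ triangle

  F⊆Hᵢ : F ⊆H H C i
  F⊆Hᵢ a with a ≟ avoid (# 0) | a ≟ avoid (# 1) | a ≟ avoid (# 2) | proj₂ triangle
  ... | yes refl | _        | _        | ∈₀ , _  , _  = ∈₀
  ... | no _     | yes refl | _        | _  , ∈₁ , _  = ∈₁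
  ... | no _     | no _     | yes refl | _  , _  , ∈₂ = ∈₂
  ... | no a≢₀   | no a≢₁   | no a≢₂   | ∈₀ , ∈₁ , ∈₂ =
    common-neighbour-in-copy C
      (φz-distinct (# 0) (# 1) λ ()) (φz-distinct (# 0) (# 2) λ ()) (φz-distinct (# 1) (# 2) λ ())
      ∈₀ ∈₁ ∈₂
      (φz-edge (# 0) a (≢-sym a≢₀)) (φz-edge (# 1) a (≢-sym a≢₁)) (φz-edge (# 2) a (≢-sym a≢₂))
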